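{- Let $\Gamma=(V,E)$ be a finite connected bipartite graph with vertex bipartition $V=\mathcal{E}\cup\mathcal{O}$, and $v_0\in\mathcal{E}$. For every $h\in\mathrm{Hom}_{v_0}(\Gamma)$, the map $f=\frac12 h|_{\mathcal{E}}$ is a centered legal labeling of $\mathcal{E}$. Conversely, for every centered legal labeling $f:\mathcal{E}\to\mathbb{Z}$, the number of $h\in\mathrm{Hom}_{v_0}(\Gamma)$ with $h|_{\mathcal{E}}=2f$ is exactly \[P(f):=\prod_{i\in\mathrm{im}(f)}2^{|B(f^{ -1}(i))|}.\]
   Context: $\mathrm{Hom}_{v_0}(\Gamma)$ is the set of $h:V\to\mathbb{Z}$ with $h(v_0)=0$ and $|h(u)-h(v)|=1$ for each edge $\{u,v\}$. A legal labeling of $\mathcal{E}$ is a map $f:\mathcal{E}\to\mathbb{Z}$ with $|f(u)-f(v)|\le1$ for all $u,v\in\mathcal{E}$ at graph distance exactly $2$; it is centered if $f(v_0)=0$. $\mathrm{im}(f)$ is the image of $f$, $f^{ -1}(i)=\{v\in\mathcal{E}:f(v)=i\}$, and for $A\subseteq\mathcal{E}$, $B(A)=\{v\in\mathcal{O}:N(v)\subseteq A\}$, where $N(v)$ is the neighborhood of $v$. -}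

module Defs where

open import Data.Nat using (ℕ; _^_)
open import Data.Integer using (ℤ; _-_; ∣_∣; _≤_; _*_; +_)
open import Data.Integer.Properties using (_≟_)
open import Data.Fin using (Fin)
open import Data.Fin.Properties using (all?)
open import Data.Bool using (Bool; true)
open import Data.Bool.Properties renaming (_≟_ to _≟ᵇ_)
open import Data.Vec using (Vec; lookup)
open import Data.List using (List; length; filter; map; deduplicate; allFin)
open import Data.Nat.ListAction using (product)
open import Data.Sum using (_⊎_; inj₁; inj₂)
open import Data.Product using (_×_; Σ; ∃)
open import Relation.Binary.PropositionalEquality using (_≡_)
open import Relation.Nullary using (¬_; Dec)
open import Relation.Nullary.Decidable using (_→-dec_)

-- A finite bipartite graph with vertex bipartition V = 𝓔 ⊎ 𝓞,
-- 𝓔 = Fin nE (even vertices), 𝓞 = Fin nO (odd vertices).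
record BipGraph : Set where
  field
    nE  : ℕ
    nO  : ℕ
    adj : Fin nE → Fin nO → Bool

module _ (Γ : BipGraph) where
  open BipGraph Γ

  Vtx : Set
  Vtx = Fin nE ⊎ Fin nO

  data Edge : Vtx → Vtx → Set where
    eo : ∀ {u w} → adj u w ≡ true → Edge (inj₁ u) (inj₂ w)
    oe : ∀ {u w} → adj u w ≡ true → Edge (inj₂ w) (inj₁ u)

  data Reach (y : Vtx) : Vtx → Set where
    here : Reach y y
    step : ∀ {x z} → Reach y x → Edge x z → Reach y z

  Connected : Set
  Connected = ∀ (x y : Vtx) → Reach x y

  -- Hom_{v0}(Γ): h given by its values on 𝓔 and on 𝓞
  IsHom : Fin nE → Vec ℤ nE → Vec ℤ nO → Set
  IsHom v₀ hE hO =
    (lookup hE v₀ ≡ + 0) ×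
    (∀ u w → adj u w ≡ true → ∣ lookup hE u - lookup hO w ∣ ≡ 1)

  -- graph distance exactly 2 between u, v ∈ 𝓔 (in a bipartite graph: distinct
  -- and having a common neighbour)
  Dist2 : Fin nE → Fin nE → Set
  Dist2 u v = ¬ (u ≡ v) × ∃ λ w → (adj u w ≡ true) × (adj v w ≡ true)

  Legal : (Fin nE → ℤ) → Set
  Legal f = ∀ u v → Dist2 u v → ∣ f u - f v ∣ Data.Nat.≤ 1

  Centered : Fin nE → (Fin nE → ℤ) → Set
  Centered v₀ f = f v₀ ≡ + 0

  im : (Fin nE → ℤ) → List ℤ
  im f = deduplicate _≟_ (map f (allFin nE))

  -- w ∈ B(f⁻¹(i))  iff  N(w) ⊆ f⁻¹(i)
  InB : (Fin nE → ℤ) → ℤ → Fin nO → Set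
  InB f i w = ∀ u → adj u w ≡ true → f u ≡ i

  InB? : (f : Fin nE → ℤ) (i : ℤ) (w : Fin nO) → Dec (InB f i w)
  InB? f i w = all? (λ u → (adj u w ≟ᵇ true) →-dec (f u ≟ i))

  sizeB : (Fin nE → ℤ) → ℤ → ℕ
  sizeB f i = length (filter (InB? f i) (allFin nO))

  P : (Fin nE → ℤ) → ℕ
  P f = product (map (λ i → 2 ^ sizeB f i) (im f))

  Lifts : Fin nE → (Fin nE → ℤ) → Vec ℤ nE × Vec ℤ nO → Set
  Lifts v₀ f (hE Data.Product., hO) = IsHom v₀ hE hO × (∀ u → lookup hE u ≡ + 2 * f u)

-- Along every walk from v₀ a homomorphism alternates parity, so h is even on 𝓔 and
-- f = h/2 is defined; two even vertices with a common neighbour w have h-values within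
-- 1 of h(w), so f is legal. Conversely, once h|𝓔 = 2f is fixed, the value at an odd
-- vertex w can be any odd number adjacent to every 2f(u), u ∈ N(w), independently of
-- the other odd vertices. Legality forces f(N(w)) to be {i} or {i, i+1}: in the first
-- case w ∈ B(f⁻¹(i)) and both 2i ± 1 are admissible, in the second only 2i + 1 is.
-- Multiplying over w and regrouping the factors by label gives P(f).
module Submission where

open import Defs
open import Algebra.Properties.CommutativeSemigroup using (interchange)
open import Data.Bool using (Bool; true; false)
import Data.Bool.Properties as Bool
open import Data.Empty using (⊥-elim)
open import Data.Fin using (Fin; zero; suc)
import Data.Fin.Properties as Fin
open import Data.Integer using (ℤ; +_; -[1+_]; _+_; _-_; _*_; ∣_∣; 0ℤ; 1ℤ; -1ℤ)
import Data.Integer.Properties as ℤ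
open import Data.Integer.Tactic.RingSolver using (solve-∀)
open import Data.List using (List; []; _∷_; [_]; length; map; filter; tabulate; allFin; cartesianProductWith)
import Data.List.Properties as List
open import Data.List.Membership.Propositional using (_∈_)
open import Data.List.Membership.Propositional.Properties
  using ( ∈-filter⁺; ∈-filter⁻; ∈-map⁺; ∈-map⁻; ∈-cartesianProductWith⁺; ∈-cartesianProductWith⁻
        ; ∈-deduplicate⁺; ∈-allFin)
open import Data.List.Relation.Unary.All as All using (All; []; _∷_)
open import Data.List.Relation.Unary.AllPairs using ([]; _∷_)
open import Data.List.Relation.Unary.Any using (here; there)
open import Data.List.Relation.Unary.Unique.Propositional using (Unique)
import Data.List.Relation.Unary.Unique.Propositional.Properties as Unique
import Data.List.Relation.Unary.Unique.DecPropositional.Properties as UniqueDec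
open import Data.Nat as ℕ using (ℕ; _^_; s≤s; z≤n)
import Data.Nat.Properties as ℕ
open import Data.Nat.ListAction using (sum; product)
open import Data.Product using (_×_; Σ; ∃; _,_; proj₁; proj₂)
open import Data.Sum using (_⊎_; inj₁; inj₂)
open import Data.Vec as Vec using (Vec; lookup)
import Data.Vec.Properties as Vec
open import Function using (_∘_; id)
open import Level using (Level)
open import Relation.Binary.PropositionalEquality
  using (_≡_; _≢_; refl; sym; trans; cong; cong₂; subst; module ≡-Reasoning)
open import Relation.Nullary using (¬_; Dec; yes; no; does)
open import Relation.Nullary.Decidable using (dec-true; dec-false; _→-dec_)
open import Relation.Unary using (Pred; Decidable)

private
  variable
    a b c p : Level
    A : Set a
    B : Set b

iverson : Bool → ℕ
iverson true  = 1
iverson false = 0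

module _ {P : Pred A p} (P? : Decidable P) where

  length-filter≡sum : ∀ xs → length (filter P? xs) ≡ sum (map (λ x → iverson (does (P? x))) xs)
  length-filter≡sum []       = refl
  length-filter≡sum (x ∷ xs) with does (P? x)
  ... | true  = cong ℕ.suc (length-filter≡sum xs)
  ... | false = length-filter≡sum xs

sum-map-zero : (g : A → ℕ) {xs : List A} → All (λ x → g x ≡ 0) xs → sum (map g xs) ≡ 0
sum-map-zero g []           = refl
sum-map-zero g (gx≡0 ∷ gxs) rewrite gx≡0 = sum-map-zero g gxs

sum-map-+ : (g h : A → ℕ) (xs : List A) →
            sum (map (λ x → g x ℕ.+ h x) xs) ≡ sum (map g xs) ℕ.+ sum (map h xs)
sum-map-+ g h []       = refl
sum-map-+ g h (x ∷ xs) = begin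
  g x ℕ.+ h x ℕ.+ sum (map (λ x → g x ℕ.+ h x) xs)    ≡⟨ cong (g x ℕ.+ h x ℕ.+_) (sum-map-+ g h xs) ⟩
  g x ℕ.+ h x ℕ.+ (sum (map g xs) ℕ.+ sum (map h xs)) ≡⟨ interchange ℕ.+-commutativeSemigroup (g x) (h x) _ _ ⟩
  g x ℕ.+ sum (map g xs) ℕ.+ (h x ℕ.+ sum (map h xs)) ∎
  where open ≡-Reasoning

sum-map-comm : (g : A → B → ℕ) (xs : List A) (ys : List B) →
               sum (map (λ x → sum (map (g x) ys)) xs) ≡ sum (map (λ y → sum (map (λ x → g x y) xs)) ys)
sum-map-comm g []       ys = sym (sum-map-zero (λ _ → 0) (All.universal (λ _ → refl) ys))
sum-map-comm g (x ∷ xs) ys = begin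
  sum (map (g x) ys) ℕ.+ sum (map (λ x → sum (map (g x) ys)) xs)
    ≡⟨ cong (sum (map (g x) ys) ℕ.+_) (sum-map-comm g xs ys) ⟩
  sum (map (g x) ys) ℕ.+ sum (map (λ y → sum (map (λ x → g x y) xs)) ys)
    ≡⟨ sum-map-+ (g x) _ ys ⟨
  sum (map (λ y → g x y ℕ.+ sum (map (λ x → g x y) xs)) ys) ∎
  where open ≡-Reasoning

sum-map-unique : (g : A → ℕ) {xs : List A} {a : A} → Unique xs → a ∈ xs →
                 (∀ x → x ≢ a → g x ≡ 0) → sum (map g xs) ≡ g a
sum-map-unique g (a∉xs ∷ _) (here refl) g≡0 =
  trans (cong (g _ ℕ.+_) (sum-map-zero g (All.map (λ a≢x → g≡0 _ (a≢x ∘ sym)) a∉xs))) (ℕ.+-identityʳ _)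
sum-map-unique g (x∉xs ∷ xs!) (there a∈xs) g≡0 =
  cong₂ ℕ._+_ (g≡0 _ (All.lookup x∉xs a∈xs)) (sum-map-unique g xs! a∈xs g≡0)

length-filter-unique : {P : Pred A p} (P? : Decidable P) {xs : List A} {a : A} →
                       Unique xs → a ∈ xs → (∀ {x} → P x → x ≡ a) → P a → length (filter P? xs) ≡ 1
length-filter-unique P? {xs} xs! a∈xs only-a Pa = begin
  length (filter P? xs)                        ≡⟨ length-filter≡sum P? xs ⟩
  sum (map (λ x → iverson (does (P? x))) xs)
    ≡⟨ sum-map-unique _ xs! a∈xs (λ x x≢a → cong iverson (dec-false (P? x) (x≢a ∘ only-a))) ⟩
  iverson (does (P? _))                        ≡⟨ cong iverson (dec-true (P? _) Pa) ⟩
  1                                            ∎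
  where open ≡-Reasoning

product-map-^ : ∀ m (g : A → ℕ) xs → product (map (λ x → m ^ g x) xs) ≡ m ^ sum (map g xs)
product-map-^ m g []       = refl
product-map-^ m g (x ∷ xs) =
  trans (cong (m ^ g x ℕ.*_) (product-map-^ m g xs)) (sym (ℕ.^-distribˡ-+-* m (g x) _))

choices : ∀ {n} → (Fin n → List A) → List (Vec A n)
choices {n = ℕ.zero}  C = [ Vec.[] ]
choices {n = ℕ.suc n} C = cartesianProductWith Vec._∷_ (C zero) (choices (C ∘ suc))

∈-choices⁺ : ∀ {n} (C : Fin n → List A) {v : Vec A n} → (∀ i → lookup v i ∈ C i) → v ∈ choices C
∈-choices⁺ {n = ℕ.zero}  C {Vec.[]}    _   = here refl
∈-choices⁺ {n = ℕ.suc n} C {x Vec.∷ v} v∈C =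
  ∈-cartesianProductWith⁺ Vec._∷_ (v∈C zero) (∈-choices⁺ (C ∘ suc) (v∈C ∘ suc))

∈-choices⁻ : ∀ {n} (C : Fin n → List A) {v : Vec A n} → v ∈ choices C → ∀ i → lookup v i ∈ C i
∈-choices⁻ {n = ℕ.suc n} C v∈ i with ∈-cartesianProductWith⁻ Vec._∷_ (C zero) (choices (C ∘ suc)) v∈
∈-choices⁻ C _ zero    | _ , _ , x∈ , _  , refl = x∈
∈-choices⁻ C _ (suc i) | _ , _ , _  , v∈ , refl = ∈-choices⁻ (C ∘ suc) v∈ i

choices-unique : ∀ {n} (C : Fin n → List A) → (∀ i → Unique (C i)) → Unique (choices C)
choices-unique {n = ℕ.zero}  C _  = [] ∷ []
choices-unique {n = ℕ.suc n} C C! =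
  Unique.cartesianProductWith⁺ Vec._∷_ Vec.∷-injective (C! zero) (choices-unique (C ∘ suc) (C! ∘ suc))

length-cartesianProductWith : ∀ {C : Set c} (f : A → B → C) xs ys →
                              length (cartesianProductWith f xs ys) ≡ length xs ℕ.* length ys
length-cartesianProductWith f []       ys = refl
length-cartesianProductWith f (x ∷ xs) ys =
  trans (List.length-++ (map (f x) ys))
        (cong₂ ℕ._+_ (List.length-map (f x) ys) (length-cartesianProductWith f xs ys))

length-choices : ∀ {n} (C : Fin n → List A) → length (choices C) ≡ product (tabulate (length ∘ C))
length-choices {n = ℕ.zero}  C = refl
length-choices {n = ℕ.suc n} C =
  trans (length-cartesianProductWith Vec._∷_ (C zero) _) (cong (length (C zero) ℕ.*_) (length-choices (C ∘ suc)))

odd : ℤ → ℤ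
odd m = + 2 * m + 1ℤ

∣i∣≡1⇒i≡±1 : ∀ i → ∣ i ∣ ≡ 1 → i ≡ 1ℤ ⊎ i ≡ -1ℤ
∣i∣≡1⇒i≡±1 (+ .1)          refl = inj₁ refl
∣i∣≡1⇒i≡±1 -[1+ ℕ.zero ]   refl = inj₂ refl
∣i∣≡1⇒i≡±1 -[1+ ℕ.suc _ ] ()

∣i∣≤1⇒i≡0,±1 : ∀ i → ∣ i ∣ ℕ.≤ 1 → i ≡ 0ℤ ⊎ i ≡ 1ℤ ⊎ i ≡ -1ℤ
∣i∣≤1⇒i≡0,±1 (+ 0)                _         = inj₁ refl
∣i∣≤1⇒i≡0,±1 (+ 1)                _         = inj₂ (inj₁ refl)
∣i∣≤1⇒i≡0,±1 (+ ℕ.suc (ℕ.suc _)) (s≤s ())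
∣i∣≤1⇒i≡0,±1 -[1+ 0 ]             _         = inj₂ (inj₂ refl)
∣i∣≤1⇒i≡0,±1 -[1+ ℕ.suc _ ]      (s≤s ())

i-j≡k⇒i≡j+k : ∀ i j k → i - j ≡ k → i ≡ j + k
i-j≡k⇒i≡j+k i j k i-j≡k = trans (i≡j+[i-j] i j) (cong (λ d → j + d) i-j≡k)
  where i≡j+[i-j] : ∀ i j → i ≡ j + (i - j)
        i≡j+[i-j] = solve-∀

i≡[i-1]+1 : ∀ i → i ≡ i - 1ℤ + 1ℤ
i≡[i-1]+1 = solve-∀

∣i-j∣≡1⇒i≡j±1 : ∀ i j → ∣ i - j ∣ ≡ 1 → i ≡ j + 1ℤ ⊎ i ≡ j - 1ℤ
∣i-j∣≡1⇒i≡j±1 i j ∣i-j∣≡1 with ∣i∣≡1⇒i≡±1 (i - j) ∣i-j∣≡1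
... | inj₁ i-j≡1  = inj₁ (i-j≡k⇒i≡j+k i j _ i-j≡1)
... | inj₂ i-j≡-1 = inj₂ (i-j≡k⇒i≡j+k i j _ i-j≡-1)

∣i-j∣≤1⇒i≡j,j±1 : ∀ i j → ∣ i - j ∣ ℕ.≤ 1 → i ≡ j ⊎ i ≡ j + 1ℤ ⊎ i ≡ j - 1ℤ
∣i-j∣≤1⇒i≡j,j±1 i j ∣i-j∣≤1 with ∣i∣≤1⇒i≡0,±1 (i - j) ∣i-j∣≤1
... | inj₁ i-j≡0         = inj₁ (ℤ.i-j≡0⇒i≡j i j i-j≡0)
... | inj₂ (inj₁ i-j≡1)  = inj₂ (inj₁ (i-j≡k⇒i≡j+k i j _ i-j≡1))
... | inj₂ (inj₂ i-j≡-1) = inj₂ (inj₂ (i-j≡k⇒i≡j+k i j _ i-j≡-1))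

∣i-a∣,∣i-[a+1]∣≤1⇒i≡a,a+1 : ∀ i a → ∣ i - a ∣ ℕ.≤ 1 → ∣ i - (a + 1ℤ) ∣ ℕ.≤ 1 → i ≡ a ⊎ i ≡ a + 1ℤ
∣i-a∣,∣i-[a+1]∣≤1⇒i≡a,a+1 i a ∣i-a∣≤1 ∣i-a-1∣≤1 with ∣i-j∣≤1⇒i≡j,j±1 i a ∣i-a∣≤1
... | inj₁ i≡a         = inj₁ i≡a
... | inj₂ (inj₁ i≡a+1) = inj₂ i≡a+1
... | inj₂ (inj₂ refl) with subst (λ d → ∣ d ∣ ℕ.≤ 1) (a-1-[a+1]≡-2 a) ∣i-a-1∣≤1
  where a-1-[a+1]≡-2 : ∀ a → a - 1ℤ - (a + 1ℤ) ≡ -[1+ 1 ]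
        a-1-[a+1]≡-2 = solve-∀
...   | s≤s ()

∣2x-c∣≡1⇒c≡odd[x-1],odd[x] : ∀ x c → ∣ + 2 * x - c ∣ ≡ 1 → c ≡ odd (x - 1ℤ) ⊎ c ≡ odd x
∣2x-c∣≡1⇒c≡odd[x-1],odd[x] x c ∣2x-c∣≡1
  with ∣i-j∣≡1⇒i≡j±1 c (+ 2 * x) (trans (ℤ.∣i-j∣≡∣j-i∣ c (+ 2 * x)) ∣2x-c∣≡1)
... | inj₁ c≡2x+1 = inj₂ c≡2x+1
... | inj₂ c≡2x-1 = inj₁ (trans c≡2x-1 (2x-1≡odd[x-1] x))
  where 2x-1≡odd[x-1] : ∀ x → + 2 * x - 1ℤ ≡ + 2 * (x - 1ℤ) + 1ℤ
        2x-1≡odd[x-1] = solve-∀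

∣i-odd[k]∣≡1⇒i≡2k,2[k+1] : ∀ i k → ∣ i - odd k ∣ ≡ 1 → i ≡ + 2 * (k + 1ℤ) ⊎ i ≡ + 2 * k
∣i-odd[k]∣≡1⇒i≡2k,2[k+1] i k ∣i-odd[k]∣≡1 with ∣i-j∣≡1⇒i≡j±1 i (odd k) ∣i-odd[k]∣≡1
... | inj₁ i≡odd[k]+1 = inj₁ (trans i≡odd[k]+1 (odd[k]+1≡2[k+1] k))
  where odd[k]+1≡2[k+1] : ∀ k → + 2 * k + 1ℤ + 1ℤ ≡ + 2 * (k + 1ℤ)
        odd[k]+1≡2[k+1] = solve-∀
... | inj₂ i≡odd[k]-1 = inj₂ (trans i≡odd[k]-1 (odd[k]-1≡2k k))
  where odd[k]-1≡2k : ∀ k → + 2 * k + 1ℤ - 1ℤ ≡ + 2 * k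
        odd[k]-1≡2k = solve-∀

∣2x-c∣,∣2y-c∣≡1⇒∣x-y∣≤1 : ∀ x y c → ∣ + 2 * x - c ∣ ≡ 1 → ∣ + 2 * y - c ∣ ≡ 1 → ∣ x - y ∣ ℕ.≤ 1
∣2x-c∣,∣2y-c∣≡1⇒∣x-y∣≤1 x y c ∣2x-c∣≡1 ∣2y-c∣≡1 = ℕ.*-cancelˡ-≤ 2 (begin
  2 ℕ.* ∣ x - y ∣                          ≡⟨ ℤ.∣i*j∣≡∣i∣*∣j∣ (+ 2) (x - y) ⟨
  ∣ + 2 * (x - y) ∣                        ≡⟨ cong ∣_∣ (split x y c) ⟩
  ∣ (+ 2 * x - c) + (c - + 2 * y) ∣        ≤⟨ ℤ.∣i+j∣≤∣i∣+∣j∣ (+ 2 * x - c) (c - + 2 * y) ⟩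
  ∣ + 2 * x - c ∣ ℕ.+ ∣ c - + 2 * y ∣      ≡⟨ cong₂ ℕ._+_ ∣2x-c∣≡1 (trans (ℤ.∣i-j∣≡∣j-i∣ c (+ 2 * y)) ∣2y-c∣≡1) ⟩
  2 ℕ.* 1                                  ∎)
  where
    open ℕ.≤-Reasoning
    split : ∀ x y c → + 2 * (x - y) ≡ (+ 2 * x - c) + (c - + 2 * y)
    split = solve-∀

x≡m,m+1⇒∣2x-odd[m]∣≡1 : ∀ x m → x ≡ m ⊎ x ≡ m + 1ℤ → ∣ + 2 * x - odd m ∣ ≡ 1
x≡m,m+1⇒∣2x-odd[m]∣≡1 x .x (inj₁ refl) = cong ∣_∣ (2m-odd[m]≡-1 x)
  where 2m-odd[m]≡-1 : ∀ m → + 2 * m - (+ 2 * m + 1ℤ) ≡ -1ℤ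
        2m-odd[m]≡-1 = solve-∀
x≡m,m+1⇒∣2x-odd[m]∣≡1 x m (inj₂ refl) = cong ∣_∣ (2[m+1]-odd[m]≡1 m)
  where 2[m+1]-odd[m]≡1 : ∀ m → + 2 * (m + 1ℤ) - (+ 2 * m + 1ℤ) ≡ 1ℤ
        2[m+1]-odd[m]≡1 = solve-∀

odd[i-1]≢odd[i] : ∀ i → odd (i - 1ℤ) ≢ odd i
odd[i-1]≢odd[i] i eq
  with trans (sym (odd[i]-odd[i-1]≡2 i)) (trans (cong (odd i -_) eq) (ℤ.+-inverseʳ (odd i)))
  where odd[i]-odd[i-1]≡2 : ∀ i → (+ 2 * i + 1ℤ) - (+ 2 * (i - 1ℤ) + 1ℤ) ≡ + 2
        odd[i]-odd[i-1]≡2 = solve-∀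
... | ()

neighbour-of-reachable : ∀ {Γ v w} → Reach Γ (inj₁ v) (inj₂ w) → ∃ λ u → BipGraph.adj Γ u w ≡ true
neighbour-of-reachable (step _ (eo {u} u~w)) = u , u~w

module Restriction (Γ : BipGraph) (connected : Connected Γ) {v₀ : Fin (BipGraph.nE Γ)}
                   {hE : Vec ℤ (BipGraph.nE Γ)} {hO : Vec ℤ (BipGraph.nO Γ)} (hom : IsHom Γ v₀ hE hO) where
  open BipGraph Γ

  HasParity : Vtx Γ → Set
  HasParity (inj₁ u) = ∃ λ k → lookup hE u ≡ + 2 * k
  HasParity (inj₂ w) = ∃ λ k → lookup hO w ≡ odd k

  reachable⇒hasParity : ∀ {x} → Reach Γ (inj₁ v₀) x → HasParity x
  reachable⇒hasParity here = 0ℤ , proj₁ hom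
  reachable⇒hasParity (step r (eo {u} {w} u~w)) with reachable⇒hasParity r
  ... | k , hu≡2k with ∣2x-c∣≡1⇒c≡odd[x-1],odd[x] k (lookup hO w)
                         (subst (λ e → ∣ e - lookup hO w ∣ ≡ 1) hu≡2k (proj₂ hom u w u~w))
  ...   | inj₁ hw≡odd = k - 1ℤ , hw≡odd
  ...   | inj₂ hw≡odd = k , hw≡odd
  reachable⇒hasParity (step r (oe {u} {w} u~w)) with reachable⇒hasParity r
  ... | k , hw≡odd[k] with ∣i-odd[k]∣≡1⇒i≡2k,2[k+1] (lookup hE u) k
                             (subst (λ e → ∣ lookup hE u - e ∣ ≡ 1) hw≡odd[k] (proj₂ hom u w u~w))
  ...   | inj₁ hu≡2k' = k + 1ℤ , hu≡2k'
  ...   | inj₂ hu≡2k  = k , hu≡2k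

  half : Fin nE → ℤ
  half u = proj₁ (reachable⇒hasParity (connected (inj₁ v₀) (inj₁ u)))

  h≡2*half : ∀ u → lookup hE u ≡ + 2 * half u
  h≡2*half u = proj₂ (reachable⇒hasParity (connected (inj₁ v₀) (inj₁ u)))

  half-legal : Legal Γ half
  half-legal u v (_ , w , u~w , v~w) =
    ∣2x-c∣,∣2y-c∣≡1⇒∣x-y∣≤1 (half u) (half v) (lookup hO w) (edge u~w) (edge v~w)
    where
      edge : ∀ {u} → adj u w ≡ true → ∣ + 2 * half u - lookup hO w ∣ ≡ 1
      edge {u} u~w = subst (λ e → ∣ e - lookup hO w ∣ ≡ 1) (h≡2*half u) (proj₂ hom u w u~w)

  half-centered : Centered Γ v₀ half
  half-centered = ℤ.*-cancelˡ-≡ (+ 2) _ _ (trans (sym (h≡2*half v₀)) (proj₁ hom))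

module Lifting (Γ : BipGraph) (connected : Connected Γ) (v₀ : Fin (BipGraph.nE Γ))
               (f : Fin (BipGraph.nE Γ) → ℤ) (legal : Legal Γ f) where
  open BipGraph Γ

  Admissible : Fin nO → ℤ → Set
  Admissible w c = ∀ u → adj u w ≡ true → ∣ + 2 * f u - c ∣ ≡ 1

  admissible? : ∀ w → Decidable (Admissible w)
  admissible? w c = Fin.all? (λ u → (adj u w Bool.≟ true) →-dec (∣ + 2 * f u - c ∣ ℕ.≟ 1))

  neighbours-close : ∀ {u u' w} → adj u w ≡ true → adj u' w ≡ true → ∣ f u - f u' ∣ ℕ.≤ 1
  neighbours-close {u} {u'} u~w u'~w with u Fin.≟ u'
  ... | yes refl = subst (λ d → ∣ d ∣ ℕ.≤ 1) (sym (ℤ.+-inverseʳ (f u))) z≤n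
  ... | no u≢u'  = legal u u' (u≢u' , _ , u~w , u'~w)

  straddle⇒admissible : ∀ {u u' w} → adj u w ≡ true → adj u' w ≡ true → f u' ≡ f u + 1ℤ →
                        Admissible w (odd (f u))
  straddle⇒admissible {u} u~w u'~w fu'≡fu+1 x x~w =
    x≡m,m+1⇒∣2x-odd[m]∣≡1 (f x) (f u)
      (∣i-a∣,∣i-[a+1]∣≤1⇒i≡a,a+1 (f x) (f u) (neighbours-close x~w u~w)
        (subst (λ b → ∣ f x - b ∣ ℕ.≤ 1) fu'≡fu+1 (neighbours-close x~w u'~w)))

  straddle⇒admissible-unique : ∀ {u u' w c} → adj u w ≡ true → adj u' w ≡ true → f u' ≡ f u + 1ℤ →
                               Admissible w c → c ≡ odd (f u)
  straddle⇒admissible-unique {u} {u'} {c = c} u~w u'~w fu'≡fu+1 adm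
    with ∣2x-c∣≡1⇒c≡odd[x-1],odd[x] (f u) c (adm u u~w)
  ... | inj₂ c≡odd[fu] = c≡odd[fu]
  ... | inj₁ refl with trans (sym (cong ∣_∣ (2[a+1]-odd[a-1]≡3 (f u))))
                             (subst (λ b → ∣ + 2 * b - c ∣ ≡ 1) fu'≡fu+1 (adm u' u'~w))
    where 2[a+1]-odd[a-1]≡3 : ∀ a → + 2 * (a + 1ℤ) - (+ 2 * (a - 1ℤ) + 1ℤ) ≡ + 3
          2[a+1]-odd[a-1]≡3 = solve-∀
  ... | ()

  anchor : Fin nO → Fin nE
  anchor w = proj₁ (neighbour-of-reachable (connected (inj₁ v₀) (inj₂ w)))

  anchor~w : ∀ w → adj (anchor w) w ≡ true
  anchor~w w = proj₂ (neighbour-of-reachable (connected (inj₁ v₀) (inj₂ w)))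

  level : Fin nO → ℤ
  level w = f (anchor w)

  -- Any admissible value is adjacent to 2 · level w, hence one of these two.
  oddNeighbours : Fin nO → List ℤ
  oddNeighbours w = odd (level w - 1ℤ) ∷ odd (level w) ∷ []

  candidates : Fin nO → List ℤ
  candidates w = filter (admissible? w) (oddNeighbours w)

  oddNeighbours-unique : ∀ w → Unique (oddNeighbours w)
  oddNeighbours-unique w = (odd[i-1]≢odd[i] (level w) ∷ []) ∷ [] ∷ []

  admissible⇒∈candidates : ∀ {w c} → Admissible w c → c ∈ candidates w
  admissible⇒∈candidates {w} {c} adm = ∈-filter⁺ (admissible? w) c∈oddNeighbours adm
    where
      c∈oddNeighbours : c ∈ oddNeighbours w
      c∈oddNeighbours with ∣2x-c∣≡1⇒c≡odd[x-1],odd[x] (level w) c (adm (anchor w) (anchor~w w))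
      ... | inj₁ c≡odd[i-1] = here c≡odd[i-1]
      ... | inj₂ c≡odd[i]   = there (here c≡odd[i])

  ¬InB⇒outsider : ∀ {i w} → ¬ InB Γ f i w → ∃ λ u → adj u w ≡ true × f u ≢ i
  ¬InB⇒outsider {i} {w} ¬inB
    with Fin.¬∀⟶∃¬ nE _ (λ u → (adj u w Bool.≟ true) →-dec (f u ℤ.≟ i)) ¬inB
  ... | u , ¬[u~w→fu≡i] with adj u w Bool.≟ true
  ...   | yes u~w = u , u~w , λ fu≡i → ¬[u~w→fu≡i] (λ _ → fu≡i)
  ...   | no ¬u~w = ⊥-elim (¬[u~w→fu≡i] (⊥-elim ∘ ¬u~w))

  length-candidates-straddle : ∀ {u u' w} → adj u w ≡ true → adj u' w ≡ true → f u' ≡ f u + 1ℤ →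
                               odd (f u) ∈ oddNeighbours w → length (candidates w) ≡ 1
  length-candidates-straddle {w = w} u~w u'~w straddle mem =
    length-filter-unique (admissible? w) (oddNeighbours-unique w) mem
      (straddle⇒admissible-unique u~w u'~w straddle) (straddle⇒admissible u~w u'~w straddle)

  length-candidates : ∀ w (inB? : Dec (InB Γ f (level w) w)) →
                      length (candidates w) ≡ 2 ^ iverson (does inB?)
  length-candidates w (yes inB) = cong length (List.filter-all (admissible? w) (lower ∷ upper ∷ []))
    where
      lower : Admissible w (odd (level w - 1ℤ))
      lower u u~w =
        x≡m,m+1⇒∣2x-odd[m]∣≡1 (f u) (level w - 1ℤ) (inj₂ (trans (inB u u~w) (i≡[i-1]+1 (level w))))
      upper : Admissible w (odd (level w))
      upper u u~w = x≡m,m+1⇒∣2x-odd[m]∣≡1 (f u) (level w) (inj₁ (inB u u~w))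
  length-candidates w (no ¬inB) with ¬InB⇒outsider ¬inB
  ... | u , u~w , fu≢i with ∣i-j∣≤1⇒i≡j,j±1 (f u) (level w) (neighbours-close u~w (anchor~w w))
  ...   | inj₁ fu≡i          = ⊥-elim (fu≢i fu≡i)
  ...   | inj₂ (inj₁ fu≡i+1) = length-candidates-straddle (anchor~w w) u~w fu≡i+1 (there (here refl))
  ...   | inj₂ (inj₂ fu≡i-1) = length-candidates-straddle u~w (anchor~w w)
                                 (trans (i≡[i-1]+1 (level w)) (cong (_+ 1ℤ) (sym fu≡i-1)))
                                 (here (cong odd fu≡i-1))

  anchorInB : Fin nO → ℕ
  anchorInB w = iverson (does (InB? Γ f (level w) w))

  -- Each odd vertex lies in B(f⁻¹(i)) for at most one i, namely i = level w.
  ∑sizeB≡∑anchorInB : sum (map (sizeB Γ f) (im Γ f)) ≡ sum (map anchorInB (allFin nO))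
  ∑sizeB≡∑anchorInB = begin
    sum (map (sizeB Γ f) (im Γ f))
      ≡⟨ cong sum (List.map-cong (λ i → length-filter≡sum (InB? Γ f i) (allFin nO)) (im Γ f)) ⟩
    sum (map (λ i → sum (map (inB i) (allFin nO))) (im Γ f))
      ≡⟨ sum-map-comm inB (im Γ f) (allFin nO) ⟩
    sum (map (λ w → sum (map (λ i → inB i w) (im Γ f))) (allFin nO))
      ≡⟨ cong sum (List.map-cong only-level (allFin nO)) ⟩
    sum (map anchorInB (allFin nO)) ∎
    where
      open ≡-Reasoning
      inB : ℤ → Fin nO → ℕ
      inB i w = iverson (does (InB? Γ f i w))
      only-level : ∀ w → sum (map (λ i → inB i w) (im Γ f)) ≡ anchorInB w
      only-level w = sum-map-unique (λ i → inB i w) (UniqueDec.deduplicate-! ℤ._≟_ (map f (allFin nE)))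
        (∈-deduplicate⁺ ℤ._≟_ (∈-map⁺ f (∈-allFin (anchor w))))
        (λ i i≢level → cong iverson (dec-false (InB? Γ f i w)
                                        (λ inB → i≢level (sym (inB (anchor w) (anchor~w w))))))

  twice-f : Vec ℤ nE
  twice-f = Vec.tabulate (λ u → + 2 * f u)

  lifts : List (Vec ℤ nE × Vec ℤ nO)
  lifts = map (twice-f ,_) (choices candidates)

  lifts-unique : Unique lifts
  lifts-unique = Unique.map⁺ (cong proj₂)
    (choices-unique candidates (λ w → Unique.filter⁺ (admissible? w) (oddNeighbours-unique w)))

  length-lifts : length lifts ≡ P Γ f
  length-lifts = begin
    length lifts
      ≡⟨ List.length-map _ (choices candidates) ⟩
    length (choices candidates)
      ≡⟨ length-choices candidates ⟩
    product (tabulate (length ∘ candidates))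
      ≡⟨ cong product (List.tabulate-cong (λ w → length-candidates w (InB? Γ f (level w) w))) ⟩
    product (tabulate (λ w → 2 ^ anchorInB w))
      ≡⟨ cong product (List.map-tabulate id (λ w → 2 ^ anchorInB w)) ⟨
    product (map (λ w → 2 ^ anchorInB w) (allFin nO))
      ≡⟨ product-map-^ 2 anchorInB (allFin nO) ⟩
    2 ^ sum (map anchorInB (allFin nO))
      ≡⟨ cong (2 ^_) ∑sizeB≡∑anchorInB ⟨
    2 ^ sum (map (sizeB Γ f) (im Γ f))
      ≡⟨ product-map-^ 2 (sizeB Γ f) (im Γ f) ⟨
    P Γ f ∎
    where open ≡-Reasoning

  lookup-twice-f : ∀ u → lookup twice-f u ≡ + 2 * f u
  lookup-twice-f = Vec.lookup∘tabulate (λ u → + 2 * f u)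

  admissible⇒lift : Centered Γ v₀ f → ∀ {hO} → (∀ w → Admissible w (lookup hO w)) →
                    Lifts Γ v₀ f (twice-f , hO)
  admissible⇒lift centered {hO} adm = (centered′ , edges) , lookup-twice-f
    where
      centered′ : lookup twice-f v₀ ≡ + 0
      centered′ = trans (lookup-twice-f v₀) (cong (+ 2 *_) centered)
      edges : ∀ u w → adj u w ≡ true → ∣ lookup twice-f u - lookup hO w ∣ ≡ 1
      edges u w u~w rewrite lookup-twice-f u = adm w u u~w

  lift⇒admissible : ∀ {hE hO} → Lifts Γ v₀ f (hE , hO) →
                    hE ≡ twice-f × (∀ w → Admissible w (lookup hO w))
  lift⇒admissible {hE} {hO} ((_ , edges) , hE≡2f) =
    trans (sym (Vec.tabulate∘lookup hE)) (Vec.tabulate-cong hE≡2f) ,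
    λ w u u~w → subst (λ e → ∣ e - lookup hO w ∣ ≡ 1) (hE≡2f u) (edges u w u~w)

  lifts-complete : ∀ h → Lifts Γ v₀ f h → h ∈ lifts
  lifts-complete (hE , hO) lift with lift⇒admissible {hE} {hO} lift
  ... | refl , adm = ∈-map⁺ (twice-f ,_) (∈-choices⁺ candidates (admissible⇒∈candidates ∘ adm))

  lifts-sound : Centered Γ v₀ f → All (Lifts Γ v₀ f) lifts
  lifts-sound centered = All.tabulate λ h∈lifts → lift (∈-map⁻ (twice-f ,_) h∈lifts)
    where
      lift : ∀ {h} → (∃ λ hO → hO ∈ choices candidates × h ≡ (twice-f , hO)) → Lifts Γ v₀ f h
      lift (hO , hO∈ , refl) =
        admissible⇒lift centered {hO} (λ w → proj₂ (∈-filter⁻ (admissible? w) (∈-choices⁻ candidates hO∈ w)))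

lemma4p2 : (Γ : BipGraph) → Connected Γ → (v₀ : Fin (BipGraph.nE Γ)) →
    ((hE : Vec ℤ (BipGraph.nE Γ)) (hO : Vec ℤ (BipGraph.nO Γ)) → IsHom Γ v₀ hE hO →
      Σ (Fin (BipGraph.nE Γ) → ℤ) λ f →
        (∀ u → lookup hE u ≡ + 2 * f u) × Legal Γ f × Centered Γ v₀ f)
    ×
    ((f : Fin (BipGraph.nE Γ) → ℤ) → Legal Γ f → Centered Γ v₀ f →
      Σ (List (Vec ℤ (BipGraph.nE Γ) × Vec ℤ (BipGraph.nO Γ))) λ L →
        Unique L × All (Lifts Γ v₀ f) L ×
        (∀ h → Lifts Γ v₀ f h → h ∈ L) × (length L ≡ P Γ f))
lemma4p2 Γ connected v₀ =
  (λ hE hO hom → let open Restriction Γ connected {v₀} {hE} {hO} hom in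
     half , h≡2*half , half-legal , half-centered) ,
  (λ f legal centered → let open Lifting Γ connected v₀ f legal in
     lifts , lifts-unique , lifts-sound centered , lifts-complete , length-lifts)
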